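{- For every formal logic program $\mathcal P$ over $\mathscr V^\star$ and every literal marker $\Omega$ for $\mathcal P$, every foundational extensor for $(\mathcal P,\Omega)$ is implicative.
   Context: Syntax. $\mathscr V$ is a vocabulary: a set of function symbols and predicate symbols, each with an arity (possibly $0$), not containing the binary logical symbol $\doteq$ (syntactic identity). $\mathscr V^\star$ is a countable subset of $\mathscr V$. Variables come from a fixed repetition-free enumeration $(v_i)_{i\in\mathbb N}$. Terms over $\mathscr V$ (resp. $\mathscr V^\star$) are built from variables and function symbols of $\mathscr V$ (resp. $\mathscr V^\star$); closed terms contain no variables. Statements over $\mathscr V$ form the smallest set containing literals (atoms $\wp(t_1,\dots,t_n)$ and negated atoms $\neg\wp(t_1,\dots,t_n)$), identities $t\doteq t'$, distinctions $t\not\doteq t'$, $\bigvee X$ and $\bigwedge X$ for countable sets $X$ of statements, and $\exists x\,\varphi$, $\forall x\,\varphi$ whenever $x$ is free in $\varphi$; statements over $\mathscr V^\star$ likewise. $e[t_1/x_1,\dots,t_n/x_n]$ is simultaneous substitution of closed terms for free variables. An instance of $e$ is a closed expression $e[t_1/x_1,\dots,t_n/x_n]$; a tuple $(t'_1,\dots,t'_n)$ of closed terms is an instance of $(t_1,\dots,t_n)$ iff each $t'_i$ is an instance of $t_i$. A set $S$ of literals is consistent iff no closed atom $\varphi$ has both $\varphi$ and $\neg\varphi$ as instances of members of $S$. Forcing. For a consistent set $S$ of closed literals and closed statements: $S\Vdash t\doteq t'$ iff identical; $S\Vdash t\not\doteq t'$ iff distinct; $S\Vdash\lambda$ (literal)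 iff $\lambda\in S$; $\bigvee X$ iff some member forced; $\bigwedge X$ iff all; $\exists x\varphi$ iff $\varphi[t/x]$ forced for some closed term $t$ over $\mathscr V$; $\forall x\varphi$ iff for all. For arbitrary $S$ and a statement or set $T$: $S\Vdash T$ iff $S$ is inconsistent or the closed instances of members of $S$ force every closed instance of (every member of) $T$. Programs. A formal logic program over $\mathscr V^\star$ is a family $\mathcal P=((\varphi^+_\wp,\varphi^-_\wp))_\wp$ indexed by the predicate symbols of $\mathscr V^\star$, with $\varphi^\pm_\wp$ statements over $\mathscr V^\star$ with free variables among $v_1,\dots,v_n$ for $n$-ary $\wp$. $[\mathcal P]$ is the $\subseteq$-least set of literals over $\mathscr V^\star$ such that for all $n$-ary $\wp$ of $\mathscr V^\star$ and terms $t_1,\dots,t_n$ over $\mathscr V^\star$: $\wp(t_1,\dots,t_n)\in[\mathcal P]$ iff $[\mathcal P]\Vdash\varphi^+_\wp[t'_1/v_1,\dots,t'_n/v_n]$ for every instance $(t'_1,\dots,t'_n)$ of $(t_1,\dots,t_n)$, and likewise for $\neg\wp(t_1,\dots,t_n)$ with $\varphi^-_\wp$. Derivation sets. For a formal logic program $\mathcal Q=((\psi^+_\wp,\psi^-_\wp))_\wp$ and a literal $\chi$ over $\mathscr V^\star$ of the form $\wp(t_1,\dots,t_n)$ (resp. $\neg\wp(t_1,\dots,t_n)$), a one-step support of $\chi$ is a set $Y$ of literals over $\mathscr V^\star$ with $Y\Vdash\psi^+_\wp[t'_1/v_1,\dots,t'_n/v_n]$ (resp. $\psi^-_\wp[\dots]$)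 for every instance $(t'_1,\dots,t'_n)$ of $(t_1,\dots,t_n)$. $\mathcal Q[\cdot]$ is the largest assignment of a set $\mathcal Q[\chi]$ of sets of literals to each literal $\chi$ over $\mathscr V^\star$ such that every $X\in\mathcal Q[\chi]$ has the form $X=\bigcup_{\psi\in Y}(\{\psi\}\cup X_\psi)$ for some one-step support $Y$ of $\chi$ and some $X_\psi\in\mathcal Q[\psi]$ ($\psi\in Y$). Transformations. An occurrence of a literal in a statement $\varphi$ is a leaf of the parse tree of $\varphi$ labelled by that literal (formally, the set of substatements along the branch to that leaf). A literal marker for a program $\mathcal Q$ is a family $\Omega=((O^+_\wp,O^-_\wp))_\wp$ with $O^\pm_\wp$ a set of occurrences of literals in the statements $\psi^\pm_\wp$ of $\mathcal Q$. For a literal $\lambda$ with free variables exactly the distinct $x_1,\dots,x_n$ and a set $E$ of literals, $U(\lambda,E)$ is the set of all statements $\exists y_1\dots\exists y_m(x_1\doteq t_1\wedge\dots\wedge x_n\doteq t_n)$ with $t_i$ terms over $\mathscr V^\star$, $y_1,\dots,y_m$ the distinct variables occurring in the $t_i$ (all distinct from the $x_i$), such that for every instance $(t'_1,\dots,t'_n)$ of $(t_1,\dots,t_n)$, $\lambda[t'_1/x_1,\dots,t'_n/x_n]$ is an instance of a member of $E$ (for $n=0$: $\{\bigwedge\varnothing\}$ if $\lambda$ is an instance of a member of $E$, else $\varnothing$). $\circledcirc^O_E\varphi$ is obtained from $\varphi$ by replacing each occurrence in $O$ of a literal $\lambda$ by $\bigvee(\{\lambda\}\cup U(\lambda,E))$.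 $\mathcal P+_\Omega E=((\circledcirc^{O^+_\wp}_E\varphi^+_\wp,\circledcirc^{O^-_\wp}_E\varphi^-_\wp))_\wp$, and $\Omega+E$ is the literal marker for $\mathcal P+_\Omega E$ selecting, in each $\circledcirc^{O^\pm_\wp}_E\varphi^\pm_\wp$, exactly the occurrences of the disjuncts $\lambda$ of the statements $\bigvee(\{\lambda\}\cup U(\lambda,E))$ that replaced the selected occurrences. An extensor for $(\mathcal P,\Omega)$ is a set $E$ of literals over $\mathscr V^\star$ with $[\mathcal P+_\Omega E]$ consistent; it is implicative iff $E\subseteq[\mathcal P+_\Omega E]$; it is supporting iff for every $\psi\in E$ some member of $(\mathcal P+_\Omega E)[\psi]$ is included in $[\mathcal P]$. For an ordinal $\alpha$, an extensor $E$ for $(\mathcal P,\Omega)$ is $\alpha$-foundational iff there is a sequence $(E_\beta)_{\beta<\alpha}$ of sets of literals with $E=\bigcup_{\beta<\alpha}E_\beta$ such that for every $\beta<\alpha$, $E_\beta$ is a supporting extensor for $(\mathcal P+_\Omega\bigcup_{\gamma<\beta}E_\gamma,\ \Omega+\bigcup_{\gamma<\beta}E_\gamma)$. An extensor $E$ for $(\mathcal P,\Omega)$ is foundational iff there is a sequence $(E_\alpha)_{\alpha\in\mathrm{Ord}}$ of sets of literals with $E=\bigcup_{\alpha}E_\alpha$ such that for every ordinal $\alpha$, $\bigcup_{\beta<\alpha}E_\beta$ is an $\alpha$-foundational extensor for $(\mathcal P,\Omega)$. -}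

module Defs where

open import Level as L using (Level; Lift; lift) renaming (_⊔_ to _⊔ℓ_; suc to lsuc; zero to 0ℓ)
open import Data.Nat as ℕ using (ℕ; zero; suc; _≟_; _≤_)
open import Data.Bool using (Bool; true; false; T; if_then_else_)
open import Data.Fin using (Fin)
open import Data.Vec as Vec using (Vec; []; _∷_)
open import Data.List as List using (List; []; _∷_; _++_; length; filter; upTo)
open import Data.List.Membership.Propositional using (_∈_)
open import Data.List.Relation.Unary.Any using (any?)
open import Data.Maybe using (Maybe; just; nothing; maybe)
open import Data.Product using (Σ; _×_; _,_; proj₁; proj₂)
open import Data.Sum using (_⊎_; inj₁; inj₂)
open import Data.Unit.Polymorphic using (⊤; tt)
open import Data.Empty.Polymorphic using (⊥)
open import Relation.Nullary using (¬_; does)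
open import Relation.Binary.PropositionalEquality using (_≡_; _≢_)
open import Induction.WellFounded using (WellFounded)

1ℓ : Level
1ℓ = lsuc 0ℓ

_⇔_ : ∀ {a b} → Set a → Set b → Set (a ⊔ℓ b)
A ⇔ B = (A → B) × (B → A)

-- Vocabulary 𝒱 together with the countable sub-vocabulary 𝒱⋆.
-- Subsets of 𝒱 are given by characteristic functions.

record Voc : Set₁ where
  field
    Fun     : Set
    Prd     : Set
    farity  : Fun → ℕ
    parity  : Prd → ℕ
    starF   : Fun → Bool
    starP   : Prd → Bool
    codeF   : Fun → ℕ
    codeF-inj : ∀ f g → T (starF f) → T (starF g) → codeF f ≡ codeF g → f ≡ g
    codeP   : Prd → ℕ
    codeP-inj : ∀ p q → T (starP p) → T (starP q) → codeP p ≡ codeP q → p ≡ q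

module _ (V : Voc) where
  open Voc V

  data Term : Set where
    var : ℕ → Term
    app : (f : Fun) → Vec Term (farity f) → Term

  data Literal : Set where
    pos : (p : Prd) → Vec Term (parity p) → Literal
    neg : (p : Prd) → Vec Term (parity p) → Literal

  -- Countable sets of statements are represented by indexed families
  -- (countability is imposed by WF below).
  data Stmt : Set₂ where
    lit  : Literal → Stmt
    eqₛ  : Term → Term → Stmt
    neqₛ : Term → Term → Stmt
    ⋁    : (I : Set₁) → (I → Stmt) → Stmt
    ⋀    : (I : Set₁) → (I → Stmt) → Stmt
    ∃ₛ   : ℕ → Stmt → Stmt
    ∀ₛ   : ℕ → Stmt → Stmt

  LitSet : Set₂
  LitSet = Literal → Set₁

  mutual
    vars : Term → List ℕ
    vars (var x) = x ∷ []
    vars (app f ts) = varsV ts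

    varsV : ∀ {n} → Vec Term n → List ℕ
    varsV [] = []
    varsV (t ∷ ts) = vars t ++ varsV ts

  varsL : Literal → List ℕ
  varsL (pos p ts) = varsV ts
  varsL (neg p ts) = varsV ts

  mutual
    subst : (ℕ → Term) → Term → Term
    subst σ (var x) = σ x
    subst σ (app f ts) = app f (substV σ ts)

    substV : ∀ {n} → (ℕ → Term) → Vec Term n → Vec Term n
    substV σ [] = []
    substV σ (t ∷ ts) = subst σ t ∷ substV σ ts

  substL : (ℕ → Term) → Literal → Literal
  substL σ (pos p ts) = pos p (substV σ ts)
  substL σ (neg p ts) = neg p (substV σ ts)

  upd : (ℕ → Term) → ℕ → Term → ℕ → Term
  upd σ x t y = if does (x ≟ y) then t else σ y

  -- simultaneous substitution of closed terms (capture cannot occur)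
  substS : (ℕ → Term) → Stmt → Stmt
  substS σ (lit l) = lit (substL σ l)
  substS σ (eqₛ t u) = eqₛ (subst σ t) (subst σ u)
  substS σ (neqₛ t u) = neqₛ (subst σ t) (subst σ u)
  substS σ (⋁ I f) = ⋁ I (λ i → substS σ (f i))
  substS σ (⋀ I f) = ⋀ I (λ i → substS σ (f i))
  substS σ (∃ₛ x φ) = ∃ₛ x (substS (upd σ x (var x)) φ)
  substS σ (∀ₛ x φ) = ∀ₛ x (substS (upd σ x (var x)) φ)

  nth : ∀ {n} → Vec Term n → ℕ → Maybe Term
  nth [] _ = nothing
  nth (t ∷ ts) zero = just t
  nth (t ∷ ts) (suc k) = nth ts k

  tupσ : ∀ {n} → Vec Term n → ℕ → Term
  tupσ ts zero = var zero
  tupσ ts (suc k) = maybe (λ t → t) (var (suc k)) (nth ts k)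

  listσ : (xs : List ℕ) → Vec Term (length xs) → ℕ → Term
  listσ [] [] y = var y
  listσ (x ∷ xs) (t ∷ ts) y = if does (x ≟ y) then t else listσ xs ts y

  FreeIn : ℕ → Stmt → Set₁
  FreeIn x (lit l) = Lift 1ℓ (x ∈ varsL l)
  FreeIn x (eqₛ t u) = Lift 1ℓ (x ∈ vars t ⊎ x ∈ vars u)
  FreeIn x (neqₛ t u) = Lift 1ℓ (x ∈ vars t ⊎ x ∈ vars u)
  FreeIn x (⋁ I f) = Σ I (λ i → FreeIn x (f i))
  FreeIn x (⋀ I f) = Σ I (λ i → FreeIn x (f i))
  FreeIn x (∃ₛ y φ) = Lift 1ℓ (x ≢ y) × FreeIn x φ
  FreeIn x (∀ₛ y φ) = Lift 1ℓ (x ≢ y) × FreeIn x φ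

  WF : Stmt → Set₁
  WF (lit l) = ⊤
  WF (eqₛ t u) = ⊤
  WF (neqₛ t u) = ⊤
  WF (⋁ I f) = Σ (I → ℕ) (λ c → ∀ i j → c i ≡ c j → i ≡ j) × (∀ i → WF (f i))
  WF (⋀ I f) = Σ (I → ℕ) (λ c → ∀ i j → c i ≡ c j → i ≡ j) × (∀ i → WF (f i))
  WF (∃ₛ x φ) = FreeIn x φ × WF φ
  WF (∀ₛ x φ) = FreeIn x φ × WF φ

  mutual
    StarT : Term → Set
    StarT (var x) = Lift 0ℓ (Data.Unit.Polymorphic.⊤)
    StarT (app f ts) = T (starF f) × StarV ts

    StarV : ∀ {n} → Vec Term n → Set
    StarV [] = ⊤
    StarV (t ∷ ts) = StarT t × StarV ts

  StarL : Literal → Set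
  StarL (pos p ts) = T (starP p) × StarV ts
  StarL (neg p ts) = T (starP p) × StarV ts

  StarS : Stmt → Set₁
  StarS (lit l) = Lift 1ℓ (StarL l)
  StarS (eqₛ t u) = Lift 1ℓ (StarT t × StarT u)
  StarS (neqₛ t u) = Lift 1ℓ (StarT t × StarT u)
  StarS (⋁ I f) = ∀ i → StarS (f i)
  StarS (⋀ I f) = ∀ i → StarS (f i)
  StarS (∃ₛ x φ) = StarS φ
  StarS (∀ₛ x φ) = StarS φ

  Closed : Term → Set
  Closed t = vars t ≡ []

  ClosedV : ∀ {n} → Vec Term n → Set
  ClosedV ts = varsV ts ≡ []

  ClosedL : Literal → Set
  ClosedL l = varsL l ≡ []

  InstV : ∀ {n} → Vec Term n → Vec Term n → Set
  InstV ts' ts = ClosedV ts' × Σ (ℕ → Term) (λ σ → ts' ≡ substV σ ts)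

  InstL : Literal → Literal → Set
  InstL l' l = ClosedL l' × Σ (ℕ → Term) (λ σ → l' ≡ substL σ l)

  InstMem : ∀ {ℓ} → (Literal → Set ℓ) → Literal → Set ℓ
  InstMem S l' = Σ Literal (λ l → S l × InstL l' l)

  Inconsistent : ∀ {ℓ} → (Literal → Set ℓ) → Set ℓ
  Inconsistent S = Σ Prd (λ p → Σ (Vec Term (parity p)) (λ ts →
                     ClosedV ts × InstMem S (pos p ts) × InstMem S (neg p ts)))

  Consistent : ∀ {ℓ} → (Literal → Set ℓ) → Set ℓ
  Consistent S = ¬ Inconsistent S

  -- Forcing.  Force S σ φ means  S ⊩ φ[σ]  (σ accumulates the closed
  -- terms substituted for the bound variables met so far).

  Force : ∀ {ℓ} → (Literal → Set ℓ) → (ℕ → Term) → Stmt → Set (1ℓ ⊔ℓ ℓ)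
  Force {ℓ} S σ (lit l) = Lift (1ℓ ⊔ℓ ℓ) (S (substL σ l))
  Force {ℓ} S σ (eqₛ t u) = Lift (1ℓ ⊔ℓ ℓ) (subst σ t ≡ subst σ u)
  Force {ℓ} S σ (neqₛ t u) = Lift (1ℓ ⊔ℓ ℓ) (¬ (subst σ t ≡ subst σ u))
  Force S σ (⋁ I f) = Σ I (λ i → Force S σ (f i))
  Force S σ (⋀ I f) = ∀ i → Force S σ (f i)
  Force S σ (∃ₛ x φ) = Σ Term (λ t → Closed t × Force S (upd σ x t) φ)
  Force S σ (∀ₛ x φ) = ∀ t → Closed t → Force S (upd σ x t) φ

  ForceSet : ∀ {ℓ} → (Literal → Set ℓ) → Stmt → Set (1ℓ ⊔ℓ ℓ)
  ForceSet S φ = Inconsistent S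
               ⊎ (∀ τ → (∀ x → FreeIn x φ → Closed (τ x)) → Force (InstMem S) τ φ)

  record Prog : Set₂ where
    field
      φ⁺ : (p : Prd) → T (starP p) → Stmt
      φ⁻ : (p : Prd) → T (starP p) → Stmt

  open Prog

  FormalStmt : ℕ → Stmt → Set₁
  FormalStmt n φ = WF φ × StarS φ × (∀ x → FreeIn x φ → Lift 1ℓ (1 ≤ x × x ≤ n))

  IsFormal : Prog → Set₁
  IsFormal P = ∀ p (s : T (starP p)) →
    FormalStmt (parity p) (φ⁺ P p s) × FormalStmt (parity p) (φ⁻ P p s)

  Model : Prog → LitSet → Set₁
  Model P S = (∀ l → S l → StarL l) ×
    (∀ p (s : T (starP p)) (ts : Vec Term (parity p)) → StarV ts →
      (S (pos p ts) ⇔ (∀ ts' → InstV ts' ts → ForceSet S (substS (tupσ ts') (φ⁺ P p s))))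
    × (S (neg p ts) ⇔ (∀ ts' → InstV ts' ts → ForceSet S (substS (tupσ ts') (φ⁻ P p s)))))

  ⟦_⟧ : Prog → Literal → Set₂
  ⟦ P ⟧ l = ∀ (S : LitSet) → Model P S → S l

  OneStep : Prog → Literal → LitSet → Set₁
  OneStep Q (pos p ts) Y = ∀ (s : T (starP p)) ts' → InstV ts' ts →
                             ForceSet Y (substS (tupσ ts') (φ⁺ Q p s))
  OneStep Q (neg p ts) Y = ∀ (s : T (starP p)) ts' → InstV ts' ts →
                             ForceSet Y (substS (tupσ ts') (φ⁻ Q p s))

  Assignment : Set₂
  Assignment = Literal → LitSet → Set₁

  GoodAssignment : Prog → Assignment → Set₂
  GoodAssignment Q A = ∀ χ → StarL χ → ∀ X → A χ X →
    Σ LitSet (λ Y → (∀ l → Y l → StarL l) × OneStep Q χ Y ×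
      Σ (Literal → LitSet) (λ Xs → (∀ ψ → Y ψ → A ψ (Xs ψ)) ×
        (∀ l → X l ⇔ Σ Literal (λ ψ → Y ψ × (l ≡ ψ ⊎ Xs ψ l)))))

  -- Q[χ] : the largest such assignment (union of all of them)
  Deriv : Prog → Literal → LitSet → Set₂
  Deriv Q χ X = Lift (lsuc 1ℓ) (StarL χ) × Σ Assignment (λ A → GoodAssignment Q A × A χ X)

  Pos : Stmt → Set₁
  Pos (lit l) = ⊤
  Pos (eqₛ t u) = ⊥
  Pos (neqₛ t u) = ⊥
  Pos (⋁ I f) = Σ I (λ i → Pos (f i))
  Pos (⋀ I f) = Σ I (λ i → Pos (f i))
  Pos (∃ₛ x φ) = Pos φ
  Pos (∀ₛ x φ) = Pos φ

  record Marker (P : Prog) : Set₂ where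
    field
      O⁺ : (p : Prd) (s : T (starP p)) → Pos (φ⁺ P p s) → Bool
      O⁻ : (p : Prd) (s : T (starP p)) → Pos (φ⁻ P p s) → Bool

  open Marker

  sortedVars : List ℕ → List ℕ
  sortedVars xs = filter (λ i → any? (λ y → i ≟ y) xs) (upTo (suc (List.foldr ℕ._⊔_ 0 xs)))

  UIdx : Literal → LitSet → Set₁
  UIdx l E = Σ (Vec Term (length xs)) (λ ts →
      Lift 1ℓ (StarV ts)
    × Lift 1ℓ (∀ y → y ∈ varsV ts → ¬ (y ∈ xs))
    × (∀ ts' → InstV ts' ts → InstMem E (substL (listσ xs ts') l)))
    where xs = sortedVars (varsL l)

  Ustmt : (l : Literal) (E : LitSet) → UIdx l E → Stmt
  Ustmt l E (ts , _) =
    List.foldr ∃ₛ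
      (⋀ (Lift 1ℓ (Fin (length xs))) (λ { (lift k) → eqₛ (var (List.lookup xs k)) (Vec.lookup ts k) }))
      (sortedVars (varsV ts))
    where xs = sortedVars (varsL l)

  replLit : LitSet → Literal → Bool → Σ Stmt (λ ψ → Pos ψ → Bool)
  replLit E l false = lit l , (λ _ → false)
  replLit E l true =
      ⋁ (⊤ {1ℓ} ⊎ UIdx l E) (λ { (inj₁ _) → lit l ; (inj₂ u) → Ustmt l E u })
    , (λ { (inj₁ _ , _) → true ; (inj₂ _ , _) → false })

  -- ⊚^O_E φ together with the new marker (selecting the λ disjuncts)
  transform : LitSet → (φ : Stmt) → (Pos φ → Bool) → Σ Stmt (λ ψ → Pos ψ → Bool)
  transform E (lit l) O = replLit E l (O tt)
  transform E (eqₛ t u) O = eqₛ t u , (λ ())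
  transform E (neqₛ t u) O = neqₛ t u , (λ ())
  transform E (⋁ I f) O =
      ⋁ I (λ i → proj₁ (transform E (f i) (λ q → O (i , q))))
    , (λ { (i , q) → proj₂ (transform E (f i) (λ q' → O (i , q'))) q })
  transform E (⋀ I f) O =
      ⋀ I (λ i → proj₁ (transform E (f i) (λ q → O (i , q))))
    , (λ { (i , q) → proj₂ (transform E (f i) (λ q' → O (i , q'))) q })
  transform E (∃ₛ x φ) O = ∃ₛ x (proj₁ (transform E φ O)) , proj₂ (transform E φ O)
  transform E (∀ₛ x φ) O = ∀ₛ x (proj₁ (transform E φ O)) , proj₂ (transform E φ O)

  extP : (P : Prog) → Marker P → LitSet → Prog
  φ⁺ (extP P Ω E) p s = proj₁ (transform E (φ⁺ P p s) (O⁺ Ω p s))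
  φ⁻ (extP P Ω E) p s = proj₁ (transform E (φ⁻ P p s) (O⁻ Ω p s))

  extΩ : (P : Prog) (Ω : Marker P) (E : LitSet) → Marker (extP P Ω E)
  O⁺ (extΩ P Ω E) p s = proj₂ (transform E (φ⁺ P p s) (O⁺ Ω p s))
  O⁻ (extΩ P Ω E) p s = proj₂ (transform E (φ⁻ P p s) (O⁻ Ω p s))

  Extensor : (P : Prog) → Marker P → LitSet → Set₂
  Extensor P Ω E = (∀ l → E l → Lift 1ℓ (StarL l)) × Consistent ⟦ extP P Ω E ⟧

  Implicative : (P : Prog) → Marker P → LitSet → Set₂
  Implicative P Ω E = ∀ l → E l → ⟦ extP P Ω E ⟧ l

  Supporting : (P : Prog) → Marker P → LitSet → Set₂
  Supporting P Ω E = ∀ ψ → E ψ →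
    Σ LitSet (λ X → Deriv (extP P Ω E) ψ X × (∀ l → X l → ⟦ P ⟧ l))

  record Ordinal : Set₁ where
    field
      Carrier : Set
      _<_     : Carrier → Carrier → Set
      <-trans : ∀ {a b c} → a < b → b < c → a < c
      <-irrefl : ∀ {a} → ¬ (a < a)
      <-tri   : ∀ a b → a < b ⊎ a ≡ b ⊎ b < a
      <-wf    : WellFounded _<_

  open Ordinal

  _<ₒ_ : Ordinal → Ordinal → Set
  β <ₒ α = Σ (Carrier α) (λ a → Σ (Carrier β → Carrier α) (λ f →
      (∀ x → _<_ α (f x) a)
    × (∀ x y → _<_ β x y ⇔ _<_ α (f x) (f y))
    × (∀ b → _<_ α b a → Σ (Carrier β) (λ x → f x ≡ b))))

  AlphaFoundational : (P : Prog) → Marker P → Ordinal → LitSet → Set₂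
  AlphaFoundational P Ω α E = Extensor P Ω E ×
    Σ (Carrier α → LitSet) (λ F →
        (∀ l → E l ⇔ Σ (Carrier α) (λ b → F b l))
      × (∀ b → let U = λ l → Σ (Carrier α) (λ c → _<_ α c b × F c l) in
               Extensor (extP P Ω U) (extΩ P Ω U) (F b)
             × Supporting (extP P Ω U) (extΩ P Ω U) (F b)))

  Foundational : (P : Prog) → Marker P → LitSet → Set₂
  Foundational P Ω E = Extensor P Ω E ×
    Σ (Ordinal → LitSet) (λ Es →
        (∀ l → E l ⇔ Σ Ordinal (λ α → Es α l))
      × (∀ α → AlphaFoundational P Ω α (λ l → Σ Ordinal (λ β → β <ₒ α × Es β l))))

{-# OPTIONS --safe #-}
module Submission where

-- Let l lie in the foundational extensor E.  Then l enters at some stage b of some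
-- α-foundational decomposition, so it is supported over U = ⋃_{c<b} F c: there is a
-- one-step support Y of l for (𝒫 + U) + F b with Y ⊆ [𝒫 + U].  Adding literals of E
-- only adds disjuncts, so (𝒫 + U) + F b and 𝒫 + U are both weaker than 𝒫 + E; hence
-- every model S of 𝒫 + E contains [𝒫 + U] ⊇ Y, forces the body of l in 𝒫 + E, and
-- therefore contains l.

open import Defs
open import Level using (lift)
open import Data.Bool using (true; false)
open import Data.Bool.Properties using (T-irrelevant)
open import Data.Unit using (tt) renaming (⊤ to ⊤₀)
open import Data.Empty using () renaming (⊥ to ⊥₀)
open import Data.Product using (Σ; _×_; _,_; proj₁; proj₂)
open import Data.Sum using (_⊎_; inj₁; inj₂)
open import Data.Sum.Relation.Binary.LeftOrder
  using (_⊎-<_; ₁∼₂; ₁∼₁; ₂∼₂; drop-inj₁; ⊎-<-transitive; ⊎-<-wellFounded)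
open import Relation.Binary.PropositionalEquality using (_≡_; refl) renaming (subst to ≡-subst)
open import Relation.Unary using (_⊆_)
open import Induction.WellFounded using (acc)

module _ (V : Voc) where
  open Prog
  open Marker

  -- The clause on free variables lets the closing substitutions quantified in ForceSet
  -- be transferred from ψ to φ.
  record _⊑_ (φ ψ : Stmt V) : Set₂ where
    field
      force : ∀ (A : Literal V → Set₁) σ τ → Force V A τ (substS V σ φ) → Force V A τ (substS V σ ψ)
      free  : ∀ x σ → FreeIn V x (substS V σ φ) → FreeIn V x (substS V σ ψ)
  open _⊑_

  ⊑-refl : ∀ {φ} → φ ⊑ φ
  ⊑-refl = record { force = λ _ _ _ f → f ; free = λ _ _ f → f }

  ⊑-trans : ∀ {φ ψ χ} → φ ⊑ ψ → ψ ⊑ χ → φ ⊑ χ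
  ⊑-trans φ⊑ψ ψ⊑χ = record
    { force = λ A σ τ f → force ψ⊑χ A σ τ (force φ⊑ψ A σ τ f)
    ; free  = λ x σ f → free ψ⊑χ x σ (free φ⊑ψ x σ f)
    }

  ⊑-⋁ : ∀ {I f} (i : I) → f i ⊑ ⋁ I f
  ⊑-⋁ i = record { force = λ _ _ _ f → i , f ; free = λ _ _ f → i , f }

  ⋁-least : ∀ {I f ψ} → (∀ i → f i ⊑ ψ) → ⋁ I f ⊑ ψ
  ⋁-least f⊑ψ = record
    { force = λ { A σ τ (i , f) → force (f⊑ψ i) A σ τ f }
    ; free  = λ { x σ (i , f) → free (f⊑ψ i) x σ f }
    }

  ⋁-mono : ∀ {I f g} → (∀ i → f i ⊑ g i) → ⋁ I f ⊑ ⋁ I g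
  ⋁-mono f⊑g = ⋁-least λ i → ⊑-trans (f⊑g i) (⊑-⋁ i)

  ⋀-mono : ∀ {I f g} → (∀ i → f i ⊑ g i) → ⋀ I f ⊑ ⋀ I g
  ⋀-mono f⊑g = record
    { force = λ A σ τ f i → force (f⊑g i) A σ τ (f i)
    ; free  = λ { x σ (i , f) → i , free (f⊑g i) x σ f }
    }

  ∃-mono : ∀ {x φ ψ} → φ ⊑ ψ → ∃ₛ x φ ⊑ ∃ₛ x ψ
  ∃-mono φ⊑ψ = record
    { force = λ { A σ τ (t , c , f) → t , c , force φ⊑ψ A _ _ f }
    ; free  = λ { x σ (x≢y , f) → x≢y , free φ⊑ψ x _ f }
    }

  ∀-mono : ∀ {x φ ψ} → φ ⊑ ψ → ∀ₛ x φ ⊑ ∀ₛ x ψ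
  ∀-mono φ⊑ψ = record
    { force = λ A σ τ f t c → force φ⊑ψ A _ _ (f t c)
    ; free  = λ { x σ (x≢y , f) → x≢y , free φ⊑ψ x _ f }
    }

  InstMem-mono : ∀ {S S′ : LitSet V} → S ⊆ S′ → InstMem V S ⊆ InstMem V S′
  InstMem-mono S⊆S′ (l , l∈S , inst) = l , S⊆S′ l∈S , inst

  Force-mono : ∀ {S S′ : LitSet V} → S ⊆ S′ → ∀ φ τ → Force V (InstMem V S) τ φ → Force V (InstMem V S′) τ φ
  Force-mono S⊆S′ (lit l)    τ (lift f)    = lift (InstMem-mono S⊆S′ f)
  Force-mono S⊆S′ (eqₛ t u)  τ f           = f
  Force-mono S⊆S′ (neqₛ t u) τ f           = f
  Force-mono S⊆S′ (⋁ I g)    τ (i , f)     = i , Force-mono S⊆S′ (g i) τ f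
  Force-mono S⊆S′ (⋀ I g)    τ f           = λ i → Force-mono S⊆S′ (g i) τ (f i)
  Force-mono S⊆S′ (∃ₛ x φ)   τ (t , c , f) = t , c , Force-mono S⊆S′ φ _ f
  Force-mono S⊆S′ (∀ₛ x φ)   τ f           = λ t c → Force-mono S⊆S′ φ _ (f t c)

  ForceSet-mono : ∀ {S S′ : LitSet V} → S ⊆ S′ → ∀ φ → ForceSet V S φ → ForceSet V S′ φ
  ForceSet-mono S⊆S′ φ (inj₁ (p , ts , c , i⁺ , i⁻)) =
    inj₁ (p , ts , c , InstMem-mono S⊆S′ i⁺ , InstMem-mono S⊆S′ i⁻)
  ForceSet-mono S⊆S′ φ (inj₂ f) = inj₂ λ τ closed → Force-mono S⊆S′ φ τ (f τ closed)

  ForceSet-⊑ : ∀ {φ ψ} → φ ⊑ ψ → ∀ (S : LitSet V) σ → ForceSet V S (substS V σ φ) → ForceSet V S (substS V σ ψ)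
  ForceSet-⊑ φ⊑ψ S σ (inj₁ inconsistent) = inj₁ inconsistent
  ForceSet-⊑ φ⊑ψ S σ (inj₂ f) =
    inj₂ λ τ closed → force φ⊑ψ (InstMem V S) σ τ (f τ λ x x∈φ → closed x (free φ⊑ψ x σ x∈φ))

  _⊑ₚ_ : Prog V → Prog V → Set₂
  P ⊑ₚ Q = ∀ p s → φ⁺ P p s ⊑ φ⁺ Q p s × φ⁻ P p s ⊑ φ⁻ Q p s

  OneStep-mono : ∀ Q χ {Y S : LitSet V} → Y ⊆ S → OneStep V Q χ Y → OneStep V Q χ S
  OneStep-mono Q (pos p ts) Y⊆S os s ts′ inst = ForceSet-mono Y⊆S _ (os s ts′ inst)
  OneStep-mono Q (neg p ts) Y⊆S os s ts′ inst = ForceSet-mono Y⊆S _ (os s ts′ inst)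

  OneStep-⊑ : ∀ {P Q} → P ⊑ₚ Q → ∀ χ (Y : LitSet V) → OneStep V P χ Y → OneStep V Q χ Y
  OneStep-⊑ P⊑Q (pos p ts) Y os s ts′ inst = ForceSet-⊑ (proj₁ (P⊑Q p s)) Y _ (os s ts′ inst)
  OneStep-⊑ P⊑Q (neg p ts) Y os s ts′ inst = ForceSet-⊑ (proj₂ (P⊑Q p s)) Y _ (os s ts′ inst)

  OneStepClosed : Prog V → LitSet V → Set₁
  OneStepClosed P S = ∀ χ → StarL V χ → OneStep V P χ S → S χ

  Model⇒OneStepClosed : ∀ {P Q S} → P ⊑ₚ Q → Model V Q S → OneStepClosed P S
  Model⇒OneStepClosed P⊑Q (_ , M) (pos p ts) (s , st) os =
    proj₂ (proj₁ (M p s ts st)) (OneStep-⊑ P⊑Q (pos p ts) _ os s)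
  Model⇒OneStepClosed P⊑Q (_ , M) (neg p ts) (s , st) os =
    proj₂ (proj₂ (M p s ts st)) (OneStep-⊑ P⊑Q (neg p ts) _ os s)

  Deriv⇒OneStep : ∀ {Q χ X} → Deriv V Q χ X → StarL V χ × Σ (LitSet V) λ Y → Y ⊆ X × OneStep V Q χ Y
  Deriv⇒OneStep {χ = χ} (lift st , _ , good , χ↦X) with good χ st _ χ↦X
  ... | Y , _ , os , _ , _ , X⇔ = st , Y , (λ {ψ} ψ∈Y → proj₂ (X⇔ ψ) (ψ , ψ∈Y , inj₁ refl)) , os

  module LeastModel (P : Prog V) where
    data Derivable : Literal V → Set₁ where
      derive : ∀ {χ} → StarL V χ → OneStep V P χ Derivable → Derivable χ

    Derivable-model : Model V P Derivable
    Derivable-model = (λ { l (derive st _) → st }) , λ p s ts st →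
      ( (λ { (derive _ os) → os s })
      , (λ body → derive (s , st) λ s′ → ≡-subst _ (T-irrelevant s s′) body) )
      , ( (λ { (derive _ os) → os s })
      , (λ body → derive (s , st) λ s′ → ≡-subst _ (T-irrelevant s s′) body) )

    module _ {S : LitSet V} (closed : OneStepClosed P S) where
      mutual
        Derivable⊆ : Derivable ⊆ S
        Derivable⊆ (derive {pos p ts} st os) = closed _ st λ s ts′ inst → ForceSet-Derivable _ (os s ts′ inst)
        Derivable⊆ (derive {neg p ts} st os) = closed _ st λ s ts′ inst → ForceSet-Derivable _ (os s ts′ inst)

        ForceSet-Derivable : ∀ φ → ForceSet V Derivable φ → ForceSet V S φ
        ForceSet-Derivable φ (inj₁ (p , ts , c , i⁺ , i⁻)) = inj₁ (p , ts , c , InstMem-Derivable i⁺ , InstMem-Derivable i⁻)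
        ForceSet-Derivable φ (inj₂ f) = inj₂ λ τ cl → Force-Derivable φ τ (f τ cl)

        InstMem-Derivable : InstMem V Derivable ⊆ InstMem V S
        InstMem-Derivable (l , d , inst) = l , Derivable⊆ d , inst

        Force-Derivable : ∀ φ τ → Force V (InstMem V Derivable) τ φ → Force V (InstMem V S) τ φ
        Force-Derivable (lit l)    τ (lift f)    = lift (InstMem-Derivable f)
        Force-Derivable (eqₛ t u)  τ f           = f
        Force-Derivable (neqₛ t u) τ f           = f
        Force-Derivable (⋁ I g)    τ (i , f)     = i , Force-Derivable (g i) τ f
        Force-Derivable (⋀ I g)    τ f           = λ i → Force-Derivable (g i) τ (f i)
        Force-Derivable (∃ₛ x φ)   τ (t , c , f) = t , c , Force-Derivable φ _ f
        Force-Derivable (∀ₛ x φ)   τ f           = λ t c → Force-Derivable φ _ (f t c)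

  ⟦⟧-least : ∀ {P S} → OneStepClosed P S → ∀ l → ⟦_⟧ V P l → S l
  ⟦⟧-least {P} closed l l∈⟦P⟧ = Derivable⊆ closed (l∈⟦P⟧ Derivable Derivable-model)
    where open LeastModel P

  UIdx-mono : ∀ {U E : LitSet V} → U ⊆ E → ∀ l → UIdx V l U → UIdx V l E
  UIdx-mono U⊆E l (ts , star , fresh , inst) = ts , star , fresh , λ ts′ i → InstMem-mono U⊆E (inst ts′ i)

  transform-unmarked : ∀ (E : LitSet V) φ → proj₁ (transform V E φ (λ _ → false)) ⊑ φ
  transform-unmarked E (lit l)    = ⊑-refl
  transform-unmarked E (eqₛ t u)  = ⊑-refl
  transform-unmarked E (neqₛ t u) = ⊑-refl
  transform-unmarked E (⋁ I f)    = ⋁-mono λ i → transform-unmarked E (f i)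
  transform-unmarked E (⋀ I f)    = ⋀-mono λ i → transform-unmarked E (f i)
  transform-unmarked E (∃ₛ x φ)   = ∃-mono (transform-unmarked E φ)
  transform-unmarked E (∀ₛ x φ)   = ∀-mono (transform-unmarked E φ)

  module _ {U E : LitSet V} (U⊆E : U ⊆ E) where
    -- Ustmt depends only on the tuple of terms, so U(λ,U) embeds into U(λ,E) disjunct by disjunct.
    replLit-mono : ∀ l b → proj₁ (replLit V U l b) ⊑ proj₁ (replLit V E l b)
    replLit-mono l false = ⊑-refl
    replLit-mono l true  = ⋁-least λ
      { (inj₁ _) → ⊑-⋁ (inj₁ _)
      ; (inj₂ u) → ⊑-⋁ (inj₂ (UIdx-mono U⊆E l u))
      }

    transform-mono : ∀ φ O → proj₁ (transform V U φ O) ⊑ proj₁ (transform V E φ O)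
    transform-mono (lit l)    O = replLit-mono l (O _)
    transform-mono (eqₛ t u)  O = ⊑-refl
    transform-mono (neqₛ t u) O = ⊑-refl
    transform-mono (⋁ I f)    O = ⋁-mono λ i → transform-mono (f i) λ q → O (i , q)
    transform-mono (⋀ I f)    O = ⋀-mono λ i → transform-mono (f i) λ q → O (i , q)
    transform-mono (∃ₛ x φ)   O = ∃-mono (transform-mono φ O)
    transform-mono (∀ₛ x φ)   O = ∀-mono (transform-mono φ O)

    extP-mono : ∀ P Ω → extP V P Ω U ⊑ₚ extP V P Ω E
    extP-mono P Ω p s = transform-mono (φ⁺ P p s) (O⁺ Ω p s) , transform-mono (φ⁻ P p s) (O⁻ Ω p s)

  module _ {U F E : LitSet V} (U⊆E : U ⊆ E) (F⊆E : F ⊆ E) where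
    transform-transform : ∀ φ O → let φU = transform V U φ O in
      proj₁ (transform V F (proj₁ φU) (proj₂ φU)) ⊑ proj₁ (transform V E φ O)
    transform-transform (lit l) O = replLit-transform (O _)
      where
        -- Ω + U marks only the original literal, never the new U(λ,U) disjuncts.
        replLit-transform : ∀ b → let φU = replLit V U l b in
          proj₁ (transform V F (proj₁ φU) (proj₂ φU)) ⊑ proj₁ (replLit V E l b)
        replLit-transform false = ⊑-refl
        replLit-transform true  = ⋁-least λ
          { (inj₁ _) → replLit-mono F⊆E l true
          ; (inj₂ u) → ⊑-trans (transform-unmarked F _) (⊑-⋁ (inj₂ (UIdx-mono U⊆E l u)))
          }
    transform-transform (eqₛ t u)  O = ⊑-refl
    transform-transform (neqₛ t u) O = ⊑-refl
    transform-transform (⋁ I f)    O = ⋁-mono λ i → transform-transform (f i) λ q → O (i , q)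
    transform-transform (⋀ I f)    O = ⋀-mono λ i → transform-transform (f i) λ q → O (i , q)
    transform-transform (∃ₛ x φ)   O = ∃-mono (transform-transform φ O)
    transform-transform (∀ₛ x φ)   O = ∀-mono (transform-transform φ O)

    extP-extP : ∀ P Ω → extP V (extP V P Ω U) (extΩ V P Ω U) F ⊑ₚ extP V P Ω E
    extP-extP P Ω p s = transform-transform (φ⁺ P p s) (O⁺ Ω p s) , transform-transform (φ⁻ P p s) (O⁻ Ω p s)

    Supporting⇒⊆⟦⟧ : ∀ P Ω → Supporting V (extP V P Ω U) (extΩ V P Ω U) F → ∀ l → F l → ⟦_⟧ V (extP V P Ω E) l
    Supporting⇒⊆⟦⟧ P Ω supporting l l∈F S M with supporting l l∈F
    ... | X , derivation , X⊆⟦P+U⟧ with Deriv⇒OneStep derivation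
    ...   | st , Y , Y⊆X , os =
      Model⇒OneStepClosed (extP-extP P Ω) M l st (OneStep-mono _ l Y⊆S os)
      where
        Y⊆S : Y ⊆ S
        Y⊆S {ψ} ψ∈Y = ⟦⟧-least (Model⇒OneStepClosed (extP-mono U⊆E P Ω) M) ψ (X⊆⟦P+U⟧ ψ (Y⊆X ψ∈Y))

  sucₒ : Ordinal V → Ordinal V
  sucₒ α = record
    { Carrier  = Carrier ⊎ ⊤₀
    ; _<_      = _≺_
    ; <-trans  = ⊎-<-transitive <-trans λ ()
    ; <-irrefl = λ { (₁∼₁ a<a) → <-irrefl a<a }
    ; <-tri    = tri
    ; <-wf     = ⊎-<-wellFounded <-wf λ _ → acc λ ()
    }
    where
      open Ordinal α
      _≺_ : Carrier ⊎ ⊤₀ → Carrier ⊎ ⊤₀ → Set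
      _≺_ = _<_ ⊎-< λ _ _ → ⊥₀
      tri : ∀ a b → a ≺ b ⊎ a ≡ b ⊎ b ≺ a
      tri (inj₁ a) (inj₁ b) with <-tri a b
      ... | inj₁ a<b          = inj₁ (₁∼₁ a<b)
      ... | inj₂ (inj₁ refl)  = inj₂ (inj₁ refl)
      ... | inj₂ (inj₂ b<a)   = inj₂ (inj₂ (₁∼₁ b<a))
      tri (inj₁ a) (inj₂ tt) = inj₁ ₁∼₂
      tri (inj₂ tt) (inj₁ b) = inj₂ (inj₂ ₁∼₂)
      tri (inj₂ tt) (inj₂ tt) = inj₂ (inj₁ refl)

  <ₒ-sucₒ : ∀ α → _<ₒ_ V α (sucₒ α)
  <ₒ-sucₒ α = inj₂ tt , inj₁ , (λ _ → ₁∼₂) , (λ _ _ → ₁∼₁ , drop-inj₁) , λ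
    { (inj₁ a) _ → a , refl
    ; (inj₂ _) (₂∼₂ ())
    }

  record Stage (P : Prog V) (Ω : Marker V P) (E : LitSet V) (l : Literal V) : Set₂ where
    field
      U F        : LitSet V
      U⊆E        : U ⊆ E
      F⊆E        : F ⊆ E
      l∈F        : F l
      supporting : Supporting V (extP V P Ω U) (extΩ V P Ω U) F

  Foundational⇒Stage : ∀ P Ω {E l} → Foundational V P Ω E → E l → Stage P Ω E l
  Foundational⇒Stage P Ω {E} {l} (_ , _ , E⇔Es , αfoundational) l∈E
    with proj₁ (E⇔Es l) l∈E
  ... | α , l∈Esα with αfoundational (sucₒ α)
  ... | _ , F , F⇔Es , stages with proj₁ (F⇔Es l) (α , <ₒ-sucₒ α , l∈Esα)
  ... | b , l∈Fb = record
    { U = λ l → Σ (Carrier (sucₒ α)) λ c → _<_ (sucₒ α) c b × F c l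
    ; F = F b
    ; U⊆E = λ { (c , _ , l∈Fc) → F⊆E l∈Fc }
    ; F⊆E = F⊆E
    ; l∈F = l∈Fb
    ; supporting = proj₂ (stages b)
    }
    where
      open Ordinal
      F⊆E : ∀ {c l} → F c l → E l
      F⊆E {c} {l} l∈Fc with proj₂ (F⇔Es l) (c , l∈Fc)
      ... | β , _ , l∈Esβ = proj₂ (E⇔Es l) (β , l∈Esβ)

corollary68 : (V : Voc) (P : Prog V) → IsFormal V P → (Ω : Marker V P) → (E : LitSet V)
    → Foundational V P Ω E → Implicative V P Ω E
corollary68 V P _ Ω E foundational l l∈E = Supporting⇒⊆⟦⟧ V U⊆E F⊆E P Ω supporting l l∈F
  where open Stage (Foundational⇒Stage V P Ω foundational l∈E)
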